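{- Let $\mathcal{A},\mathcal{X}\subseteq\binom{[n]_m}{k}$ be maximal intersecting with respect to $\binom{[n]_m}{k}$, and let $\mathcal{B},\mathcal{Y}\subseteq\mathcal{P}$ be maximal intersecting with respect to $\mathcal{P}$. If $\varphi(\mathcal{A})\subseteq\mathcal{B}$ and $\varphi(\mathcal{X})\subseteq\mathcal{Y}$, then $$|\mathcal{X}|-|\mathcal{A}|=\sum_{\ell=q}^{w}\bigl(C_{k,\ell}-C_{k,n-\ell}\bigr)\cdot\bigl(|\mathcal{Y}(\ell)|-|\mathcal{B}(\ell)|\bigr),$$ where $w:=\min\{k,\lfloor n/2\rfloor\}$.
   Context: $k,n\in\mathbb{N}^+$, $m\in\mathbb{N}^+\cup\{\infty\}$, $q:=\lceil k/m\rceil$ (with $\lceil k/\infty\rceil:=1$). $[n]_m$ is the multiset with exactly $m$ copies of each $i\in\{1,\dots,n\}$; a subset is $A=\{\mu_1\cdot1,\dots,\mu_n\cdot n\}$ with $0\le\mu_i\le m$, $|A|=\sum\mu_i$, and $A\cap A'$ has multiplicities $\min\{\mu_i,\mu_i'\}$; $\binom{[n]_m}{k}$ is the family of subsets of cardinality $k$. $\mathcal{P}$ is the family of nonempty proper subsets of $[n]=\{1,\dots,n\}$, and $\mathcal{F}(\ell)=\{F\in\mathcal{F}:|F|=\ell\}$. A family (of multisets in $\binom{[n]_m}{k}$, resp. of sets in $\mathcal{P}$) is intersecting if any two members have nonempty intersection, and maximal intersecting with respect to the ambient family if it is intersecting and every ambient member not in it is disjoint from some member of it. The support map $\varphi:\binom{[n]_m}{k}\to\mathcal{P}$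 sends $A$ to $\{i:\mu_i\ge1\}$, and $\varphi(\mathcal{A})=\{\varphi(A):A\in\mathcal{A}\}$. $C_{k,\ell}$ denotes the coefficient of $x^k$ in $\bigl(\sum_{i=1}^{m}x^i\bigr)^\ell$ (the sum being infinite if $m=\infty$). -}

module Defs where

open import Data.Nat using (ℕ; zero; suc; _+_; _*_; _∸_; _≤_; NonZero; _⊓_; ⌊_/2⌋)
open import Data.Nat.DivMod using (_/_)
open import Data.Bool using (Bool; true; false; T; not; _∧_; if_then_else_)
open import Data.Fin using (Fin)
open import Data.Vec using (Vec; []; _∷_; lookup; map)
open import Data.List as L using (List; []; _∷_; _++_; upTo; length; filter; concatMap)
open import Data.Product using (Σ; ∃; _×_; _,_)
open import Data.Integer as ℤ using (ℤ; +_; _-_)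
open import Relation.Binary.PropositionalEquality using (_≡_)
open import Relation.Nullary using (¬_)
open import Relation.Nullary.Decidable using (⌊_⌋)
open import Data.Nat using (_≤?_; _≟_)
import Data.Fin.Subset as S
import Data.Nat.ListAction

data Mul : Set where
  fin : (m : ℕ) → .{{NonZero m}} → Mul
  ∞   : Mul

_≤M_ : ℕ → Mul → Set
i ≤M fin m = i ≤ m
i ≤M ∞     = Data.Unit.⊤
  where import Data.Unit

_≤Mᵇ_ : ℕ → Mul → Bool
i ≤Mᵇ fin m = ⌊ i ≤? m ⌋
i ≤Mᵇ ∞     = true

-- q := ⌈k/m⌉ with ⌈k/∞⌉ := 1
ceilDiv : ℕ → Mul → ℕ
ceilDiv k (fin m) = (k + m ∸ 1) / m
ceilDiv k ∞       = 1

-- Multisets over [n]: multiplicity vectors μ = (μ_1,…,μ_n)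

MSet : ℕ → Set
MSet n = Vec ℕ n

msize : ∀ {n} → MSet n → ℕ
msize []       = 0
msize (x ∷ xs) = x + msize xs

InBinom : ∀ {n} → Mul → ℕ → MSet n → Set
InBinom {n} m k A = ((i : Fin n) → lookup A i ≤M m) × msize A ≡ k

MMeets : ∀ {n} → MSet n → MSet n → Set
MMeets {n} A A' = ∃ λ (i : Fin n) → 1 ≤ (lookup A i ⊓ lookup A' i)

MFam : ℕ → Set
MFam n = MSet n → Bool

MaxIntersectingM : ∀ {n} → Mul → ℕ → MFam n → Set
MaxIntersectingM {n} m k 𝒜 =
  ((A : MSet n) → T (𝒜 A) → InBinom m k A) ×
  ((A A' : MSet n) → T (𝒜 A) → T (𝒜 A') → MMeets A A') ×
  ((C : MSet n) → InBinom m k C → ¬ T (𝒜 C) →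
     ∃ λ (A : MSet n) → T (𝒜 A) × ¬ MMeets A C)

boxVecs : (n b : ℕ) → List (Vec ℕ n)
boxVecs zero    b = [] ∷ []
boxVecs (suc n) b = concatMap (λ x → L.map (x ∷_) (boxVecs n b)) (upTo (suc b))

-- |𝒜| for a family 𝒜 of k-multisets (each such multiset has entries ≤ k,
-- so it suffices to count over boxVecs n k)
mcard : ∀ {n} → ℕ → MFam n → ℕ
mcard {n} k 𝒜 = length (L.filter (λ A → T? (𝒜 A)) (boxVecs n k))
  where
  open import Relation.Nullary using (Dec; yes; no)
  T? : (b : Bool) → Dec (T b)
  T? = Data.Bool.T?
    where import Data.Bool

InP : ∀ {n} → S.Subset n → Set
InP F = S.Nonempty F × ¬ (F ≡ S.⊤)

SFam : ℕ → Set
SFam n = S.Subset n → Bool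

MaxIntersectingP : ∀ {n} → SFam n → Set
MaxIntersectingP {n} ℬ =
  ((B : S.Subset n) → T (ℬ B) → InP B) ×
  ((B B' : S.Subset n) → T (ℬ B) → T (ℬ B') → S.Nonempty (B S.∩ B')) ×
  ((C : S.Subset n) → InP C → ¬ T (ℬ C) →
     ∃ λ (B : S.Subset n) → T (ℬ B) × ¬ S.Nonempty (B S.∩ C))

allSubsets : (n : ℕ) → List (S.Subset n)
allSubsets zero    = [] ∷ []
allSubsets (suc n) = L.map (false ∷_) (allSubsets n) ++ L.map (true ∷_) (allSubsets n)

scardLevel : ∀ {n} → SFam n → ℕ → ℕ
scardLevel {n} ℬ ℓ = length (L.filter (λ F → T? (ℬ F ∧ ⌊ S.∣ F ∣ ≟ ℓ ⌋)) (allSubsets n))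
  where
  open import Relation.Nullary using (Dec)
  T? : (b : Bool) → Dec (T b)
  T? = Data.Bool.T?
    where import Data.Bool

φ : ∀ {n} → MSet n → S.Subset n
φ = map (λ μ → not ⌊ μ ≟ 0 ⌋)

-- C_{k,ℓ} = [x^k] (Σ_{i=1}^m x^i)^ℓ, computed by the Cauchy product
-- of power series: [x^k](g · h) = Σ_{i=0}^k [x^i]g · [x^{k-i}]h.

baseCoeff : Mul → ℕ → ℕ
baseCoeff m zero    = 0
baseCoeff m (suc i) = if suc i ≤Mᵇ m then 1 else 0

convSum : ℕ → (ℕ → ℕ → ℕ) → ℕ
convSum k f = Data.Nat.ListAction.sum (L.map (λ i → f i (k ∸ i)) (upTo (suc k)))

C : Mul → ℕ → ℕ → ℕ
C m k zero    = if ⌊ k ≟ 0 ⌋ then 1 else 0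
C m k (suc ℓ) = convSum k (λ i j → baseCoeff m i * C m j ℓ)

-- Σ_{ℓ=a}^{b} f ℓ (integer valued; empty if b < a)
sumFromTo : ℕ → ℕ → (ℕ → ℤ) → ℤ
sumFromTo a b f = L.foldr ℤ._+_ (+ 0) (L.map (λ j → f (a + j)) (upTo (suc b ∸ a)))

{-# OPTIONS --safe #-}
module Submission where

-- A maximal intersecting family 𝒜 of k-multisets with φ(𝒜) ⊆ ℬ consists of exactly the
-- k-multisets whose support lies in ℬ (two such multisets meet because their supports do), and
-- C_{k,ℓ} counts the k-multisets with a given support of size ℓ. Hence
-- |𝒳| - |𝒜| = Σ_F D(F) C_{k,|F|} with D = 1_𝒴 - 1_ℬ. A maximal intersecting subfamily of 𝒫
-- contains exactly one of F and ∁F for every F ∈ 𝒫, so D(∁F) = -D(F) and level ℓ pairs off with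
-- level n - ℓ. Levels above k carry no multisets, and levels ℓ < q carry none of ℬ or 𝒴 as soon
-- as C_{k,n-ℓ} ≠ 0: a k-multiset whose support misses fewer than q points meets every member of 𝒜,
-- whose supports have at least q points, so it lies in 𝒜 and its support in ℬ.

open import Defs
open import Data.Bool as Bool using (Bool; true; false; T; not; _∧_)
open import Data.Bool.Properties using (T-∧; T-≡; ∧-assoc; ∧-zeroʳ; not-involutive)
open import Data.Empty using (⊥-elim)
open import Data.Fin using (zero; suc)
open import Data.Fin.Subset as S using (Subset; ∣_∣; ∁; _∈_; _⊆_; Nonempty)
import Data.Fin.Subset.Properties as S
open import Data.Integer as ℤ using (ℤ; +_; -[1+_]; _+_; _-_; _*_; -_)
import Data.Integer.Properties as ℤ
open import Algebra.Properties.CommutativeSemigroup ℤ.*-commutativeSemigroup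
  using () renaming (x∙yz≈y∙xz to *-left-commute)
open import Data.Integer.Tactic.RingSolver using (solve-∀)
open import Data.List as List using (List; []; _∷_; _++_; upTo; applyUpTo; concatMap; length; filter)
open import Data.List.Membership.Propositional using () renaming (_∈_ to _∈ₗ_)
open import Data.List.Membership.Propositional.Properties using (∈-upTo⁻)
open import Data.List.Relation.Unary.Any using (here; there)
open import Data.Nat as ℕ using (ℕ; zero; suc; _∸_; _≤_; _<_; z≤n; s≤s; NonZero; _⊓_; ⌊_/2⌋; ⌈_/2⌉; _≤ᵇ_)
open import Data.Nat.DivMod using (m<n*o⇒m/o<n)
import Data.Nat.ListAction as ℕ
import Data.Nat.Properties as ℕ
open import Data.Product using (∃; _×_; _,_; proj₁; proj₂)
open import Data.Sum using (_⊎_; inj₁; inj₂; [_,_]′)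
open import Data.Unit using (tt)
open import Data.Vec using (Vec; []; _∷_; lookup; here; there)
import Data.Vec.Properties as Vec
open import Function using (_∘_; _⇔_; mk⇔; Equivalence; case_of_)
open import Relation.Binary.PropositionalEquality
open import Relation.Nullary using (¬_; Dec; yes; no; does; ¬?; _×-dec_)
open import Relation.Nullary.Decidable using (⌊_⌋; T?; toWitness; fromWitness; decidable-stable; does-⇔)

T-from : ∀ {b} → b ≡ true → T b
T-from = Equivalence.from T-≡

𝟙 : Bool → ℤ
𝟙 true  = + 1
𝟙 false = + 0

𝟙-∧ : ∀ a b → 𝟙 (a ∧ b) ≡ 𝟙 a * 𝟙 b
𝟙-∧ true  b = sym (ℤ.*-identityˡ (𝟙 b))
𝟙-∧ false b = refl

𝟙-¬T : ∀ {b} → ¬ T b → 𝟙 b ≡ + 0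
𝟙-¬T {true}  ¬T = ⊥-elim (¬T tt)
𝟙-¬T {false} _  = refl

𝟙≢0⇒T : ∀ b → 𝟙 b ≢ + 0 → T b
𝟙≢0⇒T true  _   = tt
𝟙≢0⇒T false ≢0 = ⊥-elim (≢0 refl)

𝟙-*-≢0 : ∀ b x → 𝟙 b * x ≢ + 0 → T b × x ≢ + 0
𝟙-*-≢0 true  x ≢0 = tt , λ x≡0 → ≢0 (trans (ℤ.*-identityˡ x) x≡0)
𝟙-*-≢0 false x ≢0 = ⊥-elim (≢0 refl)

Σℤ : ∀ {a} {A : Set a} → List A → (A → ℤ) → ℤ
Σℤ xs f = List.foldr _+_ (+ 0) (List.map f xs)

module _ {a} {A : Set a} where

  Σℤ-cong : ∀ (xs : List A) {f g : A → ℤ} → (∀ x → f x ≡ g x) → Σℤ xs f ≡ Σℤ xs g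
  Σℤ-cong []       f≗g = refl
  Σℤ-cong (x ∷ xs) f≗g = cong₂ _+_ (f≗g x) (Σℤ-cong xs f≗g)

  Σℤ-zero : ∀ (xs : List A) {f : A → ℤ} → (∀ x → f x ≡ + 0) → Σℤ xs f ≡ + 0
  Σℤ-zero []       f≗0 = refl
  Σℤ-zero (x ∷ xs) f≗0 = cong₂ _+_ (f≗0 x) (Σℤ-zero xs f≗0)

  Σℤ-++ : ∀ (xs ys : List A) (f : A → ℤ) → Σℤ (xs ++ ys) f ≡ Σℤ xs f + Σℤ ys f
  Σℤ-++ []       ys f = sym (ℤ.+-identityˡ _)
  Σℤ-++ (x ∷ xs) ys f = trans (cong (_+_ (f x)) (Σℤ-++ xs ys f)) (sym (ℤ.+-assoc (f x) _ _))

  Σℤ-map : ∀ {b} {B : Set b} (g : B → A) (xs : List B) (f : A → ℤ) →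
           Σℤ (List.map g xs) f ≡ Σℤ xs (f ∘ g)
  Σℤ-map g []       f = refl
  Σℤ-map g (x ∷ xs) f = cong (_+_ (f (g x))) (Σℤ-map g xs f)

  Σℤ-concatMap : ∀ {b} {B : Set b} (g : B → List A) (xs : List B) (f : A → ℤ) →
                 Σℤ (concatMap g xs) f ≡ Σℤ xs (λ x → Σℤ (g x) f)
  Σℤ-concatMap g []       f = refl
  Σℤ-concatMap g (x ∷ xs) f =
    trans (Σℤ-++ (g x) (concatMap g xs) f) (cong (_+_ (Σℤ (g x) f)) (Σℤ-concatMap g xs f))

  Σℤ-+ : ∀ (xs : List A) (f g : A → ℤ) → Σℤ xs (λ x → f x + g x) ≡ Σℤ xs f + Σℤ xs g
  Σℤ-+ []       f g = refl
  Σℤ-+ (x ∷ xs) f g = trans (cong (_+_ (f x + g x)) (Σℤ-+ xs f g)) (interchange (f x) (g x) _ _)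
    where
    interchange : ∀ a b c d → (a + b) + (c + d) ≡ (a + c) + (b + d)
    interchange = solve-∀

  Σℤ-*ˡ : ∀ (xs : List A) (c : ℤ) (f : A → ℤ) → c * Σℤ xs f ≡ Σℤ xs (λ x → c * f x)
  Σℤ-*ˡ []       c f = ℤ.*-zeroʳ c
  Σℤ-*ˡ (x ∷ xs) c f = trans (ℤ.*-distribˡ-+ c (f x) _) (cong (_+_ (c * f x)) (Σℤ-*ˡ xs c f))

  Σℤ-neg : ∀ (xs : List A) (f : A → ℤ) → - Σℤ xs f ≡ Σℤ xs (λ x → - f x)
  Σℤ-neg []       f = refl
  Σℤ-neg (x ∷ xs) f = trans (ℤ.neg-distrib-+ (f x) _) (cong (_+_ (- f x)) (Σℤ-neg xs f))

  Σℤ-- : ∀ (xs : List A) (f g : A → ℤ) → Σℤ xs f - Σℤ xs g ≡ Σℤ xs (λ x → f x - g x)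
  Σℤ-- xs f g = trans (cong (_+_ (Σℤ xs f)) (Σℤ-neg xs g)) (sym (Σℤ-+ xs f (λ x → - g x)))

  +-length-filter : ∀ (p : A → Bool) (xs : List A) → + length (filter (T? ∘ p) xs) ≡ Σℤ xs (𝟙 ∘ p)
  +-length-filter p [] = refl
  +-length-filter p (x ∷ xs) with p x
  ... | true  = trans (ℤ.pos-+ 1 _) (cong (_+_ (+ 1)) (+-length-filter p xs))
  ... | false = trans (+-length-filter p xs) (sym (ℤ.+-identityˡ _))

  +-sum : ∀ (xs : List A) (f : A → ℕ) → + ℕ.sum (List.map f xs) ≡ Σℤ xs (+_ ∘ f)
  +-sum []       f = refl
  +-sum (x ∷ xs) f = trans (ℤ.pos-+ (f x) _) (cong (_+_ (+ f x)) (+-sum xs f))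

Σℤ-swap : ∀ {a b} {A : Set a} {B : Set b} (xs : List A) (ys : List B) (f : A → B → ℤ) →
          Σℤ xs (λ x → Σℤ ys (f x)) ≡ Σℤ ys (λ y → Σℤ xs (λ x → f x y))
Σℤ-swap []       ys f = sym (Σℤ-zero ys (λ _ → refl))
Σℤ-swap (x ∷ xs) ys f =
  trans (cong (_+_ (Σℤ ys (f x))) (Σℤ-swap xs ys f)) (sym (Σℤ-+ ys (f x) _))

Σℤ-applyUpTo : ∀ (g : ℕ → ℕ) N (f : ℕ → ℤ) → Σℤ (applyUpTo g N) f ≡ Σℤ (upTo N) (f ∘ g)
Σℤ-applyUpTo g zero    f = refl
Σℤ-applyUpTo g (suc N) f = cong (_+_ (f (g 0)))
  (trans (Σℤ-applyUpTo (g ∘ suc) N f) (sym (Σℤ-applyUpTo suc N (f ∘ g))))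

Σℤ-upTo-suc : ∀ N (f : ℕ → ℤ) → Σℤ (upTo (suc N)) f ≡ f 0 + Σℤ (upTo N) (f ∘ suc)
Σℤ-upTo-suc N f = cong (_+_ (f 0)) (Σℤ-applyUpTo suc N f)

Σℤ-upTo-truncate : ∀ b k (f : ℕ → ℤ) → k ≤ b →
                   Σℤ (upTo b) (λ i → 𝟙 (suc i ≤ᵇ k) * f i) ≡ Σℤ (upTo k) f
Σℤ-upTo-truncate b       zero    f k≤b     = Σℤ-zero (upTo b) (λ _ → refl)
Σℤ-upTo-truncate (suc b) (suc k) f (s≤s k≤b) = begin
  Σℤ (upTo (suc b)) (λ i → 𝟙 (suc i ≤ᵇ suc k) * f i)
    ≡⟨ Σℤ-upTo-suc b (λ i → 𝟙 (suc i ≤ᵇ suc k) * f i) ⟩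
  + 1 * f 0 + Σℤ (upTo b) (λ i → 𝟙 (suc i ≤ᵇ k) * f (suc i))
    ≡⟨ cong₂ _+_ (ℤ.*-identityˡ (f 0)) (Σℤ-upTo-truncate b k (f ∘ suc) k≤b) ⟩
  f 0 + Σℤ (upTo k) (f ∘ suc)
    ≡⟨ Σℤ-upTo-suc k f ⟨
  Σℤ (upTo (suc k)) f ∎
  where open ≡-Reasoning

Σℤ-≢0 : ∀ {a} {A : Set a} (xs : List A) (f : A → ℤ) → Σℤ xs f ≢ + 0 → ∃ λ x → x ∈ₗ xs × f x ≢ + 0
Σℤ-≢0 []       f Σ≢0 = ⊥-elim (Σ≢0 refl)
Σℤ-≢0 (x ∷ xs) f Σ≢0 with f x ℤ.≟ + 0
... | no fx≢0 = x , here refl , fx≢0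
... | yes fx≡0 with Σℤ-≢0 xs f (λ Σ≡0 → Σ≢0 (cong₂ _+_ fx≡0 Σ≡0))
... | y , y∈xs , fy≢0 = y , there y∈xs , fy≢0

module _ (f : ℕ → ℤ) (s : ℕ) where

  private
    Σ-from : ℕ → ℕ → ℤ
    Σ-from q N = Σℤ (upTo N) (λ j → f (q ℕ.+ j) * 𝟙 ⌊ s ℕ.≟ q ℕ.+ j ⌋)

    Σ-from-suc : ∀ q N → Σ-from q (suc N) ≡ f q * 𝟙 ⌊ s ℕ.≟ q ⌋ + Σ-from (suc q) N
    Σ-from-suc q N = trans (Σℤ-upTo-suc N (λ j → f (q ℕ.+ j) * 𝟙 ⌊ s ℕ.≟ q ℕ.+ j ⌋))
      (cong₂ _+_ (cong (λ ℓ → f ℓ * 𝟙 ⌊ s ℕ.≟ ℓ ⌋) (ℕ.+-identityʳ q))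
                 (Σℤ-cong (upTo N) (λ j → cong (λ ℓ → f ℓ * 𝟙 ⌊ s ℕ.≟ ℓ ⌋) (ℕ.+-suc q j))))

    Σ-from-outside : ∀ q N → s < q ⊎ q ℕ.+ N ≤ s → Σ-from q N ≡ + 0
    Σ-from-outside q zero    _       = refl
    Σ-from-outside q (suc N) outside = trans (Σ-from-suc q N) (cong₂ _+_ δ≡0 (Σ-from-outside (suc q) N outside′))
      where
      δ≡0 : f q * 𝟙 ⌊ s ℕ.≟ q ⌋ ≡ + 0
      δ≡0 with s ℕ.≟ q
      ... | no _    = ℤ.*-zeroʳ (f q)
      ... | yes refl = ⊥-elim ([ ℕ.<-irrefl refl
                               , ℕ.<⇒≱ (ℕ.m<m+n q ℕ.z<s) ]′
                               outside)
      outside′ : s < suc q ⊎ suc q ℕ.+ N ≤ s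
      outside′ = [ inj₁ ∘ ℕ.m<n⇒m<1+n , inj₂ ∘ subst (_≤ s) (ℕ.+-suc q N) ]′ outside

    Σ-from-inside : ∀ q N → q ≤ s → s < q ℕ.+ N → Σ-from q N ≡ f s
    Σ-from-inside q zero    q≤s s<q+0 = ⊥-elim (ℕ.<⇒≱ (subst (s <_) (ℕ.+-identityʳ q) s<q+0) q≤s)
    Σ-from-inside q (suc N) q≤s s<q+N = trans (Σ-from-suc q N) (first-or-rest (s ℕ.≟ q))
      where
      first-or-rest : (s≟q : Dec (s ≡ q)) → f q * 𝟙 ⌊ s≟q ⌋ + Σ-from (suc q) N ≡ f s
      first-or-rest (yes refl) = trans (cong₂ _+_ (ℤ.*-identityʳ (f s)) (Σ-from-outside (suc q) N (inj₁ ℕ.≤-refl)))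
                                       (ℤ.+-identityʳ (f s))
      first-or-rest (no s≢q)   = trans (cong₂ _+_ (ℤ.*-zeroʳ (f q))
                                       (Σ-from-inside (suc q) N (ℕ.≤∧≢⇒< q≤s (s≢q ∘ sym))
                                                      (subst (s <_) (ℕ.+-suc q N) s<q+N)))
                                       (ℤ.+-identityˡ (f s))

  sumFromTo-δ-inside : ∀ q w → q ≤ s → s ≤ w → sumFromTo q w (λ ℓ → f ℓ * 𝟙 ⌊ s ℕ.≟ ℓ ⌋) ≡ f s
  sumFromTo-δ-inside q w q≤s s≤w = Σ-from-inside q (suc w ∸ q) q≤s
    (subst (s <_) (sym (ℕ.m+[n∸m]≡n (ℕ.m≤n⇒m≤1+n (ℕ.≤-trans q≤s s≤w)))) (s≤s s≤w))

  sumFromTo-δ-outside : ∀ q w → ¬ (q ≤ s × s ≤ w) → sumFromTo q w (λ ℓ → f ℓ * 𝟙 ⌊ s ℕ.≟ ℓ ⌋) ≡ + 0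
  sumFromTo-δ-outside q w ¬inside = Σ-from-outside q (suc w ∸ q) (outside (q ℕ.≤? s))
    where
    outside : Dec (q ≤ s) → s < q ⊎ q ℕ.+ (suc w ∸ q) ≤ s
    outside (no q≰s)  = inj₁ (ℕ.≰⇒> q≰s)
    outside (yes q≤s) = inj₂ (subst (q ℕ.+ (suc w ∸ q) ≤_) (ℕ.m+[n∸m]≡n q≤s)
      (ℕ.+-monoʳ-≤ q (ℕ.∸-monoˡ-≤ q (ℕ.≰⇒> (¬inside ∘ (q≤s ,_))))))

-- Sums over all subsets of [n]

_≟ₛ_ : ∀ {n} (F H : Subset n) → Dec (F ≡ H)
_≟ₛ_ = Vec.≡-dec Bool._≟_

∁-involutive : ∀ {n} (p : Subset n) → ∁ (∁ p) ≡ p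
∁-involutive []      = refl
∁-involutive (b ∷ p) = cong₂ _∷_ (not-involutive b) (∁-involutive p)

Σℤ-allSubsets-suc : ∀ n (f : Subset (suc n) → ℤ) →
  Σℤ (allSubsets (suc n)) f ≡ Σℤ (allSubsets n) (f ∘ (false ∷_)) + Σℤ (allSubsets n) (f ∘ (true ∷_))
Σℤ-allSubsets-suc n f =
  trans (Σℤ-++ (List.map (false ∷_) (allSubsets n)) _ f)
        (cong₂ _+_ (Σℤ-map (false ∷_) (allSubsets n) f) (Σℤ-map (true ∷_) (allSubsets n) f))

Σℤ-boxVecs-suc : ∀ n b (f : Vec ℕ (suc n) → ℤ) →
  Σℤ (boxVecs (suc n) b) f ≡ Σℤ (upTo (suc b)) (λ x → Σℤ (boxVecs n b) (f ∘ (x ∷_)))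
Σℤ-boxVecs-suc n b f =
  trans (Σℤ-concatMap (λ x → List.map (x ∷_) (boxVecs n b)) (upTo (suc b)) f)
        (Σℤ-cong (upTo (suc b)) (λ x → Σℤ-map (x ∷_) (boxVecs n b) f))

Σℤ-allSubsets-∁ : ∀ n (f : Subset n → ℤ) → Σℤ (allSubsets n) (f ∘ ∁) ≡ Σℤ (allSubsets n) f
Σℤ-allSubsets-∁ zero    f = refl
Σℤ-allSubsets-∁ (suc n) f = begin
  Σℤ (allSubsets (suc n)) (f ∘ ∁)
    ≡⟨ Σℤ-allSubsets-suc n (f ∘ ∁) ⟩
  Σℤ (allSubsets n) (f ∘ (true ∷_) ∘ ∁) + Σℤ (allSubsets n) (f ∘ (false ∷_) ∘ ∁)
    ≡⟨ cong₂ _+_ (Σℤ-allSubsets-∁ n (f ∘ (true ∷_))) (Σℤ-allSubsets-∁ n (f ∘ (false ∷_))) ⟩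
  Σℤ (allSubsets n) (f ∘ (true ∷_)) + Σℤ (allSubsets n) (f ∘ (false ∷_))
    ≡⟨ ℤ.+-comm (Σℤ (allSubsets n) (f ∘ (true ∷_))) _ ⟩
  Σℤ (allSubsets n) (f ∘ (false ∷_)) + Σℤ (allSubsets n) (f ∘ (true ∷_))
    ≡⟨ Σℤ-allSubsets-suc n f ⟨
  Σℤ (allSubsets (suc n)) f ∎
  where open ≡-Reasoning

Σℤ-allSubsets-δ : ∀ n (H : Subset n) (f : Subset n → ℤ) →
                  Σℤ (allSubsets n) (λ F → 𝟙 (does (F ≟ₛ H)) * f F) ≡ f H
Σℤ-allSubsets-δ zero    []      f = trans (ℤ.+-identityʳ _) (ℤ.*-identityˡ _)
Σℤ-allSubsets-δ (suc n) (b ∷ H) f =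
  trans (Σℤ-allSubsets-suc n (λ F → 𝟙 (does (F ≟ₛ (b ∷ H))) * f F)) (split b)
  where
  split : ∀ b → Σℤ (allSubsets n) (λ F → 𝟙 (does (false Bool.≟ b) ∧ does (F ≟ₛ H)) * f (false ∷ F))
              + Σℤ (allSubsets n) (λ F → 𝟙 (does (true Bool.≟ b) ∧ does (F ≟ₛ H)) * f (true ∷ F))
              ≡ f (b ∷ H)
  split false = trans (cong₂ _+_ (Σℤ-allSubsets-δ n H (f ∘ (false ∷_))) (Σℤ-zero (allSubsets n) (λ _ → refl)))
                      (ℤ.+-identityʳ _)
  split true  = trans (cong₂ _+_ (Σℤ-zero (allSubsets n) (λ _ → refl)) (Σℤ-allSubsets-δ n H (f ∘ (true ∷_))))
                      (ℤ.+-identityˡ _)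

x+x≡0⇒x≡0 : ∀ x → x + x ≡ + 0 → x ≡ + 0
x+x≡0⇒x≡0 (+ zero)  _  = refl
x+x≡0⇒x≡0 (+ suc _) ()
x+x≡0⇒x≡0 -[1+ _ ]  ()

Σℤ-allSubsets-∁-cancel : ∀ n (f : Subset n → ℤ) → (∀ F → f F + f (∁ F) ≡ + 0) → Σℤ (allSubsets n) f ≡ + 0
Σℤ-allSubsets-∁-cancel n f cancel = x+x≡0⇒x≡0 (Σℤ (allSubsets n) f) (begin
  Σℤ (allSubsets n) f + Σℤ (allSubsets n) f       ≡⟨ cong (_+_ (Σℤ (allSubsets n) f)) (Σℤ-allSubsets-∁ n f) ⟨
  Σℤ (allSubsets n) f + Σℤ (allSubsets n) (f ∘ ∁) ≡⟨ Σℤ-+ (allSubsets n) f (f ∘ ∁) ⟨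
  Σℤ (allSubsets n) (λ F → f F + f (∁ F))         ≡⟨ Σℤ-zero (allSubsets n) cancel ⟩
  + 0                                             ∎)
  where open ≡-Reasoning

-- Counting multisets by support

0≤Mᵇ : ∀ m → (0 ≤Mᵇ m) ≡ true
0≤Mᵇ (fin _) = refl
0≤Mᵇ ∞       = refl

T-≤Mᵇ : ∀ i m → T (i ≤Mᵇ m) ⇔ i ≤M m
T-≤Mᵇ i (fin m) = mk⇔ toWitness fromWitness
T-≤Mᵇ i ∞       = mk⇔ (λ _ → tt) (λ _ → tt)

module Counting (m : Mul) where

  -- Decides InBinom entry by entry, so that splitting off the first multiplicity is definitional.
  inBinomᵇ : ∀ {n} → ℕ → MSet n → Bool
  inBinomᵇ k []      = k ℕ.≡ᵇ 0
  inBinomᵇ k (x ∷ A) = (x ≤ᵇ k) ∧ (x ≤Mᵇ m) ∧ inBinomᵇ (k ∸ x) A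

  T-inBinomᵇ : ∀ {n} k (A : MSet n) → T (inBinomᵇ k A) ⇔ InBinom m k A
  T-inBinomᵇ k []      = mk⇔ (λ k≡0 → (λ ()) , sym (ℕ.≡ᵇ⇒≡ k 0 k≡0))
                             (λ (_ , 0≡k) → ℕ.≡⇒≡ᵇ k 0 (sym 0≡k))
  T-inBinomᵇ k (x ∷ A) = mk⇔ to from
    where
    module IH = Equivalence (T-inBinomᵇ (k ∸ x) A)

    to : T (inBinomᵇ k (x ∷ A)) → InBinom m k (x ∷ A)
    to t with Equivalence.to T-∧ t
    ... | x≤k , t′ with Equivalence.to T-∧ t′
    ... | x≤m , tA with IH.to tA
    ... | bounded , size = bounded′ , trans (cong (x ℕ.+_) size) (ℕ.m+[n∸m]≡n (ℕ.≤ᵇ⇒≤ x k x≤k))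
      where
      bounded′ : ∀ i → lookup (x ∷ A) i ≤M m
      bounded′ zero    = Equivalence.to (T-≤Mᵇ x m) x≤m
      bounded′ (suc i) = bounded i

    from : InBinom m k (x ∷ A) → T (inBinomᵇ k (x ∷ A))
    from (bounded , size) = Equivalence.from T-∧ (ℕ.≤⇒≤ᵇ x≤k , Equivalence.from T-∧
      (Equivalence.from (T-≤Mᵇ x m) (bounded zero) , IH.from ((bounded ∘ suc) , size′)))
      where
      x≤k : x ≤ k
      x≤k = subst (x ≤_) size (ℕ.m≤m+n x (msize A))
      size′ : msize A ≡ k ∸ x
      size′ = trans (sym (ℕ.m+n∸m≡n x (msize A))) (cong (_∸ x) size)

  C-suc : ∀ k ℓ → + C m k (suc ℓ) ≡ Σℤ (upTo k) (λ i → 𝟙 (suc i ≤Mᵇ m) * + C m (k ∸ suc i) ℓ)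
  C-suc k ℓ = begin
    + C m k (suc ℓ)
      ≡⟨ +-sum (upTo (suc k)) (λ i → baseCoeff m i ℕ.* C m (k ∸ i) ℓ) ⟩
    Σℤ (upTo (suc k)) (λ i → + (baseCoeff m i ℕ.* C m (k ∸ i) ℓ))
      ≡⟨ trans (Σℤ-upTo-suc k (λ i → + (baseCoeff m i ℕ.* C m (k ∸ i) ℓ))) (ℤ.+-identityˡ _) ⟩
    Σℤ (upTo k) (λ i → + (baseCoeff m (suc i) ℕ.* C m (k ∸ suc i) ℓ))
      ≡⟨ Σℤ-cong (upTo k) (λ i → +-baseCoeff-* i (C m (k ∸ suc i) ℓ)) ⟩
    Σℤ (upTo k) (λ i → 𝟙 (suc i ≤Mᵇ m) * + C m (k ∸ suc i) ℓ) ∎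
    where
    open ≡-Reasoning
    +-baseCoeff-* : ∀ i c → + (baseCoeff m (suc i) ℕ.* c) ≡ 𝟙 (suc i ≤Mᵇ m) * + c
    +-baseCoeff-* i c with suc i ≤Mᵇ m
    ... | true  = trans (cong +_ (ℕ.+-identityʳ c)) (sym (ℤ.*-identityˡ (+ c)))
    ... | false = refl

  -- The first multiplicity x is 0 (first point outside the support) or 1 ≤ x ≤ min k m, which is
  -- the recursion C_{k,ℓ+1} = Σ_{1 ≤ i ≤ min k m} C_{k-i,ℓ} of C-suc.
  count-by-support : ∀ n b k (g : Subset n → Bool) → k ≤ b →
    Σℤ (boxVecs n b) (λ A → 𝟙 (inBinomᵇ k A ∧ g (φ A)))
      ≡ Σℤ (allSubsets n) (λ F → 𝟙 (g F) * + C m k ∣ F ∣)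
  count-by-support zero b zero    g _ with g []
  ... | true  = refl
  ... | false = refl
  count-by-support zero b (suc k) g _ with g []
  ... | true  = refl
  ... | false = refl
  count-by-support (suc n) b k g k≤b = begin
    Σℤ (boxVecs (suc n) b) count
      ≡⟨ Σℤ-boxVecs-suc n b count ⟩
    Σℤ (upTo (suc b)) (λ x → Σℤ (boxVecs n b) (count ∘ (x ∷_)))
      ≡⟨ Σℤ-cong (upTo (suc b)) count-by-first-entry ⟩
    Σℤ (upTo (suc b)) (λ x → 𝟙 (x ≤ᵇ k) * (𝟙 (x ≤Mᵇ m) * rest x))
      ≡⟨ Σℤ-upTo-suc b (λ x → 𝟙 (x ≤ᵇ k) * (𝟙 (x ≤Mᵇ m) * rest x)) ⟩
    + 1 * (𝟙 (0 ≤Mᵇ m) * rest 0)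
      + Σℤ (upTo b) (λ i → 𝟙 (suc i ≤ᵇ k) * (𝟙 (suc i ≤Mᵇ m) * rest (suc i)))
      ≡⟨ cong₂ _+_ first-entry-zero first-entry-positive ⟩
    Σℤ (allSubsets n) (weight ∘ (false ∷_)) + Σℤ (allSubsets n) (weight ∘ (true ∷_))
      ≡⟨ Σℤ-allSubsets-suc n weight ⟨
    Σℤ (allSubsets (suc n)) weight ∎
    where
    open ≡-Reasoning

    count : MSet (suc n) → ℤ
    count A = 𝟙 (inBinomᵇ k A ∧ g (φ A))

    weight : Subset (suc n) → ℤ
    weight F = 𝟙 (g F) * + C m k ∣ F ∣

    rest : ℕ → ℤ
    rest x = Σℤ (allSubsets n) (λ F → 𝟙 (g (not ⌊ x ℕ.≟ 0 ⌋ ∷ F)) * + C m (k ∸ x) ∣ F ∣)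

    count-by-first-entry : ∀ x → Σℤ (boxVecs n b) (count ∘ (x ∷_)) ≡ 𝟙 (x ≤ᵇ k) * (𝟙 (x ≤Mᵇ m) * rest x)
    count-by-first-entry x = begin
      Σℤ (boxVecs n b) (count ∘ (x ∷_))
        ≡⟨ Σℤ-cong (boxVecs n b) 𝟙-split ⟩
      Σℤ (boxVecs n b) (λ A → 𝟙 (x ≤ᵇ k) * (𝟙 (x ≤Mᵇ m) * counted A))
        ≡⟨ Σℤ-*ˡ (boxVecs n b) (𝟙 (x ≤ᵇ k)) _ ⟨
      𝟙 (x ≤ᵇ k) * Σℤ (boxVecs n b) (λ A → 𝟙 (x ≤Mᵇ m) * counted A)
        ≡⟨ cong (𝟙 (x ≤ᵇ k) *_) (Σℤ-*ˡ (boxVecs n b) (𝟙 (x ≤Mᵇ m)) counted) ⟨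
      𝟙 (x ≤ᵇ k) * (𝟙 (x ≤Mᵇ m) * Σℤ (boxVecs n b) counted)
        ≡⟨ cong (λ s → 𝟙 (x ≤ᵇ k) * (𝟙 (x ≤Mᵇ m) * s))
                (count-by-support n b (k ∸ x) (λ F → g (not ⌊ x ℕ.≟ 0 ⌋ ∷ F))
                                  (ℕ.≤-trans (ℕ.m∸n≤m k x) k≤b)) ⟩
      𝟙 (x ≤ᵇ k) * (𝟙 (x ≤Mᵇ m) * rest x) ∎
      where
      counted : MSet n → ℤ
      counted A = 𝟙 (inBinomᵇ (k ∸ x) A ∧ g (not ⌊ x ℕ.≟ 0 ⌋ ∷ φ A))
      𝟙-split : ∀ A → count (x ∷ A) ≡ 𝟙 (x ≤ᵇ k) * (𝟙 (x ≤Mᵇ m) * counted A)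
      𝟙-split A = begin
        𝟙 (((x ≤ᵇ k) ∧ (x ≤Mᵇ m) ∧ inBinomᵇ (k ∸ x) A) ∧ g (φ (x ∷ A)))
          ≡⟨ cong 𝟙 (trans (∧-assoc (x ≤ᵇ k) _ _) (cong ((x ≤ᵇ k) ∧_) (∧-assoc (x ≤Mᵇ m) _ _))) ⟩
        𝟙 ((x ≤ᵇ k) ∧ (x ≤Mᵇ m) ∧ inBinomᵇ (k ∸ x) A ∧ g (φ (x ∷ A)))
          ≡⟨ trans (𝟙-∧ (x ≤ᵇ k) _) (cong (𝟙 (x ≤ᵇ k) *_) (𝟙-∧ (x ≤Mᵇ m) _)) ⟩
        𝟙 (x ≤ᵇ k) * (𝟙 (x ≤Mᵇ m) * counted A) ∎

    first-entry-zero : + 1 * (𝟙 (0 ≤Mᵇ m) * rest 0) ≡ Σℤ (allSubsets n) (weight ∘ (false ∷_))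
    first-entry-zero rewrite 0≤Mᵇ m = trans (ℤ.*-identityˡ _) (ℤ.*-identityˡ _)

    first-entry-positive : Σℤ (upTo b) (λ i → 𝟙 (suc i ≤ᵇ k) * (𝟙 (suc i ≤Mᵇ m) * rest (suc i)))
                           ≡ Σℤ (allSubsets n) (weight ∘ (true ∷_))
    first-entry-positive = begin
      Σℤ (upTo b) (λ i → 𝟙 (suc i ≤ᵇ k) * (𝟙 (suc i ≤Mᵇ m) * rest (suc i)))
        ≡⟨ Σℤ-upTo-truncate b k (λ i → 𝟙 (suc i ≤Mᵇ m) * rest (suc i)) k≤b ⟩
      Σℤ (upTo k) (λ i → a i * Σℤ (allSubsets n) (λ F → u F * c i F))
        ≡⟨ Σℤ-cong (upTo k) (λ i → Σℤ-*ˡ (allSubsets n) (a i) _) ⟩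
      Σℤ (upTo k) (λ i → Σℤ (allSubsets n) (λ F → a i * (u F * c i F)))
        ≡⟨ Σℤ-swap (upTo k) (allSubsets n) _ ⟩
      Σℤ (allSubsets n) (λ F → Σℤ (upTo k) (λ i → a i * (u F * c i F)))
        ≡⟨ Σℤ-cong (allSubsets n) (λ F → Σℤ-cong (upTo k) (λ i → *-left-commute (a i) (u F) (c i F))) ⟩
      Σℤ (allSubsets n) (λ F → Σℤ (upTo k) (λ i → u F * (a i * c i F)))
        ≡⟨ Σℤ-cong (allSubsets n) (λ F → Σℤ-*ˡ (upTo k) (u F) _) ⟨
      Σℤ (allSubsets n) (λ F → u F * Σℤ (upTo k) (λ i → a i * c i F))
        ≡⟨ Σℤ-cong (allSubsets n) (λ F → cong (u F *_) (C-suc k ∣ F ∣)) ⟨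
      Σℤ (allSubsets n) (weight ∘ (true ∷_)) ∎
      where
      a : ℕ → ℤ
      a i = 𝟙 (suc i ≤Mᵇ m)
      u : Subset n → ℤ
      u F = 𝟙 (g (true ∷ F))
      c : ℕ → Subset n → ℤ
      c i F = + C m (k ∸ suc i) ∣ F ∣

  count-with-support : ∀ n k (H : Subset n) →
    Σℤ (boxVecs n k) (λ A → 𝟙 (inBinomᵇ k A ∧ does (φ A ≟ₛ H))) ≡ + C m k ∣ H ∣
  count-with-support n k H = trans (count-by-support n k k (λ F → does (F ≟ₛ H)) ℕ.≤-refl)
                                   (Σℤ-allSubsets-δ n H (λ F → + C m k ∣ F ∣))

  ∃-with-support : ∀ {n} k (H : Subset n) → C m k ∣ H ∣ ≢ 0 → ∃ λ A → InBinom m k A × φ A ≡ H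
  ∃-with-support {n} k H C≢0
    with Σℤ-≢0 (boxVecs n k) _ (C≢0 ∘ ℤ.+-injective ∘ trans (sym (count-with-support n k H)))
  ... | A , _ , counted≢0 with φ A ≟ₛ H
  ...   | yes φA≡H = A , Equivalence.to (T-inBinomᵇ k A) (proj₁ (Equivalence.to T-∧ (𝟙≢0⇒T _ counted≢0))) , φA≡H
  ...   | no _     = ⊥-elim (counted≢0 (cong 𝟙 (∧-zeroʳ _)))

-- Vanishing of the coefficients C_{k,ℓ}

C-suc≢0 : ∀ m k ℓ → C m k (suc ℓ) ≢ 0 →
          ∃ λ i → i < k × T (suc i ≤Mᵇ m) × C m (k ∸ suc i) ℓ ≢ 0
C-suc≢0 m k ℓ C≢0 with Σℤ-≢0 (upTo k) _ (C≢0 ∘ ℤ.+-injective ∘ trans (Counting.C-suc m k ℓ))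
... | i , i∈upTo , term≢0 with 𝟙-*-≢0 (suc i ≤Mᵇ m) _ term≢0
... | i≤m , C′≢0 = i , ∈-upTo⁻ i∈upTo , i≤m , C′≢0 ∘ cong (+_)

C≢0⇒ℓ≤k : ∀ m k ℓ → C m k ℓ ≢ 0 → ℓ ≤ k
C≢0⇒ℓ≤k m k zero    _   = z≤n
C≢0⇒ℓ≤k m k (suc ℓ) C≢0 with C-suc≢0 m k ℓ C≢0
... | i , i<k , _ , C′≢0 = ℕ.≤-trans (s≤s (C≢0⇒ℓ≤k m (k ∸ suc i) ℓ C′≢0)) (ℕ.∸-monoʳ-< (s≤s z≤n) i<k)

C≢0⇒k≤m*ℓ : ∀ m .{{_ : NonZero m}} k ℓ → C (fin m) k ℓ ≢ 0 → k ≤ m ℕ.* ℓ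
C≢0⇒k≤m*ℓ m zero    zero    _   = z≤n
C≢0⇒k≤m*ℓ m (suc k) zero    C≢0 = ⊥-elim (C≢0 refl)
C≢0⇒k≤m*ℓ m k       (suc ℓ) C≢0 with C-suc≢0 (fin m) k ℓ C≢0
... | i , i<k , i<m , C′≢0 = begin
  k                       ≡⟨ ℕ.m+[n∸m]≡n i<k ⟨
  suc i ℕ.+ (k ∸ suc i)   ≤⟨ ℕ.+-mono-≤ (toWitness i<m) (C≢0⇒k≤m*ℓ m (k ∸ suc i) ℓ C′≢0) ⟩
  m ℕ.+ m ℕ.* ℓ           ≡⟨ ℕ.*-suc m ℓ ⟨
  m ℕ.* suc ℓ             ∎
  where open ℕ.≤-Reasoning

ceilDiv-≤ : ∀ m .{{_ : NonZero m}} k s → k ≤ s ℕ.* m → ceilDiv k (fin m) ≤ s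
ceilDiv-≤ (suc m) k s k≤s*m = ℕ.<⇒≤pred (m<n*o⇒m/o<n (begin-strict
  k ℕ.+ suc m ∸ 1       ≡⟨ cong (_∸ 1) (ℕ.+-suc k m) ⟩
  k ℕ.+ m               <⟨ ℕ.+-monoʳ-< k (ℕ.n<1+n m) ⟩
  k ℕ.+ suc m           ≤⟨ ℕ.+-monoˡ-≤ (suc m) k≤s*m ⟩
  s ℕ.* suc m ℕ.+ suc m ≡⟨ ℕ.+-comm (s ℕ.* suc m) (suc m) ⟩
  suc s ℕ.* suc m       ∎))
  where open ℕ.≤-Reasoning

C-below-ceilDiv : ∀ m k ℓ → 1 ≤ k → ℓ < ceilDiv k m → C m k ℓ ≡ 0
C-below-ceilDiv (fin m) k       ℓ       _ ℓ<q = decidable-stable (C (fin m) k ℓ ℕ.≟ 0) λ C≢0 →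
  ℕ.<⇒≱ ℓ<q (ceilDiv-≤ m k ℓ (subst (k ≤_) (ℕ.*-comm m ℓ) (C≢0⇒k≤m*ℓ m k ℓ C≢0)))
C-below-ceilDiv ∞       (suc k) zero    _ _   = refl
C-below-ceilDiv ∞       (suc k) (suc ℓ) _ (s≤s ())

C-above : ∀ m k ℓ → k < ℓ → C m k ℓ ≡ 0
C-above m k ℓ k<ℓ = decidable-stable (C m k ℓ ℕ.≟ 0) λ C≢0 → ℕ.<⇒≱ k<ℓ (C≢0⇒ℓ≤k m k ℓ C≢0)

-- Supports and intersecting families

msize≤m*∣φ∣ : ∀ m {n} (A : MSet n) → (∀ i → lookup A i ≤ m) → msize A ≤ m ℕ.* ∣ φ A ∣
msize≤m*∣φ∣ m []          _       = z≤n
msize≤m*∣φ∣ m (zero  ∷ A) bounded = msize≤m*∣φ∣ m A (bounded ∘ suc)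
msize≤m*∣φ∣ m (suc x ∷ A) bounded = subst (suc x ℕ.+ msize A ≤_) (sym (ℕ.*-suc m ∣ φ A ∣))
  (ℕ.+-mono-≤ (bounded zero) (msize≤m*∣φ∣ m A (bounded ∘ suc)))

1≤msize⇒1≤∣φ∣ : ∀ {n} (A : MSet n) → 1 ≤ msize A → 1 ≤ ∣ φ A ∣
1≤msize⇒1≤∣φ∣ (zero  ∷ A) 1≤msize = 1≤msize⇒1≤∣φ∣ A 1≤msize
1≤msize⇒1≤∣φ∣ (suc x ∷ A) _       = s≤s z≤n

ceilDiv≤∣φ∣ : ∀ m k {n} (A : MSet n) → 1 ≤ k → InBinom m k A → ceilDiv k m ≤ ∣ φ A ∣
ceilDiv≤∣φ∣ (fin m) k A _   (bounded , size) = ceilDiv-≤ m k ∣ φ A ∣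
  (subst₂ _≤_ size (ℕ.*-comm m ∣ φ A ∣) (msize≤m*∣φ∣ m A bounded))
ceilDiv≤∣φ∣ ∞       k A 1≤k (_ , size)       = 1≤msize⇒1≤∣φ∣ A (subst (1 ≤_) (sym size) 1≤k)

∈φ⇒1≤ : ∀ {n} (A : MSet n) i → i ∈ φ A → 1 ≤ lookup A i
∈φ⇒1≤ (suc x ∷ A) zero    here       = s≤s z≤n
∈φ⇒1≤ (x     ∷ A) (suc i) (there i∈) = ∈φ⇒1≤ A i i∈

supports-meet⇒MMeets : ∀ {n} (A A′ : MSet n) → Nonempty (φ A S.∩ φ A′) → MMeets A A′
supports-meet⇒MMeets A A′ (i , i∈) with S.x∈p∩q⁻ (φ A) (φ A′) i∈
... | i∈A , i∈A′ = i , ℕ.⊓-glb (∈φ⇒1≤ A i i∈A) (∈φ⇒1≤ A′ i i∈A′)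

InP? : ∀ {n} (F : Subset n) → Dec (InP F)
InP? F = S.nonempty? F ×-dec ¬? (F ≟ₛ S.⊤)

InP-∁ : ∀ {n} {F : Subset n} → InP F → InP (∁ F)
InP-∁ {F = F} ((x , x∈F) , F≢⊤) =
  ∁-nonempty , λ ∁F≡⊤ → S.x∈p⇒x∉∁p x∈F (subst (x ∈_) (sym ∁F≡⊤) S.∈⊤)
  where
  ∁-nonempty : Nonempty (∁ F)
  ∁-nonempty = decidable-stable (S.nonempty? (∁ F)) λ ∁F-empty →
    F≢⊤ (S.⊆-antisym S.⊆⊤ (λ {y} _ → S.x∉∁p⇒x∈p (λ y∈∁F → ∁F-empty (y , y∈∁F))))

p∩∁p-empty : ∀ {n} (p : Subset n) → ¬ Nonempty (p S.∩ ∁ p)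
p∩∁p-empty p (x , x∈p∩∁p) with S.x∈p∩q⁻ p (∁ p) x∈p∩∁p
... | x∈p , x∈∁p = S.x∈p⇒x∉∁p x∈p x∈∁p

module MaximalIntersectingP {n} {ℬ : SFam n} (maxℬ : MaxIntersectingP ℬ) where

  private
    ⊆𝒫 : ∀ B → T (ℬ B) → InP B
    ⊆𝒫 = proj₁ maxℬ
    intersecting : ∀ B B′ → T (ℬ B) → T (ℬ B′) → Nonempty (B S.∩ B′)
    intersecting = proj₁ (proj₂ maxℬ)
    maximal : ∀ C → InP C → ¬ T (ℬ C) → ∃ λ B → T (ℬ B) × ¬ Nonempty (B S.∩ C)
    maximal = proj₂ (proj₂ maxℬ)

  ∈⇒∁∉ : ∀ F → T (ℬ F) → ¬ T (ℬ (∁ F))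
  ∈⇒∁∉ F F∈ ∁F∈ = p∩∁p-empty F (intersecting F (∁ F) F∈ ∁F∈)

  ∉⇒∁∈ : ∀ F → InP F → ¬ T (ℬ F) → T (ℬ (∁ F))
  ∉⇒∁∈ F F∈𝒫 F∉ = decidable-stable (T? (ℬ (∁ F))) λ ∁F∉ →
    let B  , B∈  , B∩F-empty   = maximal F F∈𝒫 F∉
        B′ , B′∈ , B′∩∁F-empty = maximal (∁ F) (InP-∁ F∈𝒫) ∁F∉
        x  , x∈B∩B′ = intersecting B B′ B∈ B′∈
        x∈B , x∈B′ = S.x∈p∩q⁻ B B′ x∈B∩B′
    in case x S.∈? F of λ where
         (yes x∈F) → B∩F-empty (x , S.x∈p∩q⁺ (x∈B , x∈F))
         (no x∉F)  → B′∩∁F-empty (x , S.x∈p∩q⁺ (x∈B′ , S.x∉p⇒x∈∁p x∉F))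

  𝟙∈+𝟙∁∈ : ∀ F → 𝟙 (ℬ F) + 𝟙 (ℬ (∁ F)) ≡ 𝟙 ⌊ InP? F ⌋
  𝟙∈+𝟙∁∈ F with InP? F | ℬ F in F∈ | ℬ (∁ F) in ∁F∈
  ... | yes _    | true  | true  = ⊥-elim (∈⇒∁∉ F (T-from F∈) (T-from ∁F∈))
  ... | yes _    | true  | false = refl
  ... | yes _    | false | true  = refl
  ... | yes F∈𝒫  | false | false = ⊥-elim (subst T ∁F∈ (∉⇒∁∈ F F∈𝒫 (subst T F∈)))
  ... | no F∉𝒫   | true  | _     = ⊥-elim (F∉𝒫 (⊆𝒫 F (T-from F∈)))
  ... | no F∉𝒫   | false | true  = ⊥-elim (F∉𝒫 (subst InP (∁-involutive F) (InP-∁ (⊆𝒫 (∁ F) (T-from ∁F∈)))))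
  ... | no _     | false | false = refl

module SupportsInMaximalIntersecting
  {n k} (m : Mul) {𝒜 : MFam n} {ℬ : SFam n}
  (max𝒜 : MaxIntersectingM m k 𝒜) (maxℬ : MaxIntersectingP ℬ)
  (φ𝒜⊆ℬ : ∀ A → T (𝒜 A) → T (ℬ (φ A))) where

  open Counting m
  open MaximalIntersectingP maxℬ using (∈⇒∁∉)

  private
    ⊆binom : ∀ A → T (𝒜 A) → InBinom m k A
    ⊆binom = proj₁ max𝒜
    maximal : ∀ C → InBinom m k C → ¬ T (𝒜 C) → ∃ λ A → T (𝒜 A) × ¬ MMeets A C
    maximal = proj₂ (proj₂ max𝒜)

  𝒜≡inBinomᵇ∧ℬ∘φ : ∀ A → 𝒜 A ≡ inBinomᵇ k A ∧ ℬ (φ A)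
  𝒜≡inBinomᵇ∧ℬ∘φ A = does-⇔ (mk⇔ to from) (T? (𝒜 A)) (T? (inBinomᵇ k A ∧ ℬ (φ A)))
    where
    to : T (𝒜 A) → T (inBinomᵇ k A ∧ ℬ (φ A))
    to A∈ = Equivalence.from T-∧ (Equivalence.from (T-inBinomᵇ k A) (⊆binom A A∈) , φ𝒜⊆ℬ A A∈)
    from : T (inBinomᵇ k A ∧ ℬ (φ A)) → T (𝒜 A)
    from t = decidable-stable (T? (𝒜 A)) λ A∉ →
      let A∈binom , φA∈ = Equivalence.to T-∧ t
          A′ , A′∈ , A′∩A-empty = maximal A (Equivalence.to (T-inBinomᵇ k A) A∈binom) A∉
      in A′∩A-empty (supports-meet⇒MMeets A′ A (proj₁ (proj₂ maxℬ) (φ A′) (φ A) (φ𝒜⊆ℬ A′ A′∈) φA∈))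

  +mcard≡Σ : + mcard k 𝒜 ≡ Σℤ (allSubsets n) (λ F → 𝟙 (ℬ F) * + C m k ∣ F ∣)
  +mcard≡Σ = begin
    + mcard k 𝒜
      ≡⟨ +-length-filter 𝒜 (boxVecs n k) ⟩
    Σℤ (boxVecs n k) (𝟙 ∘ 𝒜)
      ≡⟨ Σℤ-cong (boxVecs n k) (cong 𝟙 ∘ 𝒜≡inBinomᵇ∧ℬ∘φ) ⟩
    Σℤ (boxVecs n k) (λ A → 𝟙 (inBinomᵇ k A ∧ ℬ (φ A)))
      ≡⟨ count-by-support n k k ℬ ℕ.≤-refl ⟩
    Σℤ (allSubsets n) (λ F → 𝟙 (ℬ F) * + C m k ∣ F ∣) ∎
    where open ≡-Reasoning

  large-support-∈ : 1 ≤ k → ∀ A → InBinom m k A → ∣ ∁ (φ A) ∣ < ceilDiv k m → T (𝒜 A)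
  large-support-∈ 1≤k A A∈binom ∣∁φA∣<q = decidable-stable (T? (𝒜 A)) λ A∉ →
    let A′ , A′∈ , A′∩A-empty = maximal A A∈binom A∉
        φA′⊆∁φA : φ A′ ⊆ ∁ (φ A)
        φA′⊆∁φA {i} i∈φA′ = S.x∉p⇒x∈∁p λ i∈φA →
          A′∩A-empty (supports-meet⇒MMeets A′ A (i , S.x∈p∩q⁺ (i∈φA′ , i∈φA)))
    in ℕ.<⇒≱ (ℕ.≤-<-trans (S.p⊆q⇒∣p∣≤∣q∣ φA′⊆∁φA) ∣∁φA∣<q)
             (ceilDiv≤∣φ∣ m k A′ 1≤k (⊆binom A′ A′∈))

  -- Some k-multiset has support ∁ G; it avoids only the small set G, so it lies in 𝒜.
  small-∉ : 1 ≤ k → ∀ G → ∣ G ∣ < ceilDiv k m → C m k (n ∸ ∣ G ∣) ≢ 0 → ¬ T (ℬ G)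
  small-∉ 1≤k G ∣G∣<q C≢0
    with ∃-with-support k (∁ G) (subst (λ s → C m k s ≢ 0) (sym (S.∣∁p∣≡n∸∣p∣ G)) C≢0)
  ... | A , A∈binom , φA≡∁G = λ G∈ → ∈⇒∁∉ G G∈ (subst (T ∘ ℬ) φA≡∁G (φ𝒜⊆ℬ A A∈))
    where
    ∣∁φA∣<q : ∣ ∁ (φ A) ∣ < ceilDiv k m
    ∣∁φA∣<q = subst (λ H → ∣ H ∣ < ceilDiv k m) (sym (trans (cong ∁ φA≡∁G) (∁-involutive G))) ∣G∣<q
    A∈ : T (𝒜 A)
    A∈ = large-support-∈ 1≤k A A∈binom ∣∁φA∣<q

⌈n/2⌉≤1+⌊n/2⌋ : ∀ n → ⌈ n /2⌉ ≤ suc ⌊ n /2⌋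
⌈n/2⌉≤1+⌊n/2⌋ zero          = z≤n
⌈n/2⌉≤1+⌊n/2⌋ (suc zero)    = s≤s z≤n
⌈n/2⌉≤1+⌊n/2⌋ (suc (suc n)) = s≤s (⌈n/2⌉≤1+⌊n/2⌋ n)

≤⌊n/2⌋⇒⌊n/2⌋≤n∸ : ∀ n {s} → s ≤ ⌊ n /2⌋ → ⌊ n /2⌋ ≤ n ∸ s
≤⌊n/2⌋⇒⌊n/2⌋≤n∸ n {s} s≤⌊n/2⌋ = ℕ.m+n≤o⇒m≤o∸n ⌊ n /2⌋ (begin
  ⌊ n /2⌋ ℕ.+ s       ≤⟨ ℕ.+-monoʳ-≤ ⌊ n /2⌋ (ℕ.≤-trans s≤⌊n/2⌋ (ℕ.⌊n/2⌋≤⌈n/2⌉ n)) ⟩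
  ⌊ n /2⌋ ℕ.+ ⌈ n /2⌉ ≡⟨ ℕ.⌊n/2⌋+⌈n/2⌉≡n n ⟩
  n                   ∎)
  where
  open ℕ.≤-Reasoning

⌊n/2⌋<⇒n∸≤⌊n/2⌋ : ∀ n {s} → ⌊ n /2⌋ < s → n ∸ s ≤ ⌊ n /2⌋
⌊n/2⌋<⇒n∸≤⌊n/2⌋ n {s} ⌊n/2⌋<s = ℕ.m≤n+o⇒m∸n≤o n s (begin
  n                   ≡⟨ ℕ.⌊n/2⌋+⌈n/2⌉≡n n ⟨
  ⌊ n /2⌋ ℕ.+ ⌈ n /2⌉ ≤⟨ ℕ.+-monoʳ-≤ ⌊ n /2⌋ (ℕ.≤-trans (⌈n/2⌉≤1+⌊n/2⌋ n) ⌊n/2⌋<s) ⟩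
  ⌊ n /2⌋ ℕ.+ s       ≡⟨ ℕ.+-comm ⌊ n /2⌋ s ⟩
  s ℕ.+ ⌊ n /2⌋       ∎)
  where
  open ℕ.≤-Reasoning

≤⌊n/2⌋∧n∸≤⌊n/2⌋⇒≡ : ∀ n {s} → s ≤ n → s ≤ ⌊ n /2⌋ → n ∸ s ≤ ⌊ n /2⌋ → s ≡ n ∸ s
≤⌊n/2⌋∧n∸≤⌊n/2⌋⇒≡ n {s} s≤n s≤⌊n/2⌋ n∸s≤⌊n/2⌋ = ℕ.≤-antisym
  (ℕ.≤-trans s≤⌊n/2⌋ (≤⌊n/2⌋⇒⌊n/2⌋≤n∸ n s≤⌊n/2⌋))
  (subst (n ∸ s ≤_) (ℕ.m∸[m∸n]≡n s≤n) (ℕ.≤-trans n∸s≤⌊n/2⌋ (≤⌊n/2⌋⇒⌊n/2⌋≤n∸ n n∸s≤⌊n/2⌋)))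

+scardLevel≡Σ : ∀ {n} (ℬ : SFam n) ℓ →
                + scardLevel ℬ ℓ ≡ Σℤ (allSubsets n) (λ F → 𝟙 (ℬ F) * 𝟙 ⌊ ∣ F ∣ ℕ.≟ ℓ ⌋)
+scardLevel≡Σ {n} ℬ ℓ = trans (+-length-filter (λ F → ℬ F ∧ ⌊ ∣ F ∣ ℕ.≟ ℓ ⌋) (allSubsets n))
                              (Σℤ-cong (allSubsets n) (λ F → 𝟙-∧ (ℬ F) _))

*-distribʳ-- : ∀ x y z → x * z - y * z ≡ (x - y) * z
*-distribʳ-- = solve-∀

module CardinalityDifference
  {n k} (1≤k : 1 ≤ k) (m : Mul) {𝒜 𝒳 : MFam n} {ℬ 𝒴 : SFam n}
  (max𝒜 : MaxIntersectingM m k 𝒜) (max𝒳 : MaxIntersectingM m k 𝒳)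
  (maxℬ : MaxIntersectingP ℬ) (max𝒴 : MaxIntersectingP 𝒴)
  (φ𝒜⊆ℬ : ∀ A → T (𝒜 A) → T (ℬ (φ A))) (φ𝒳⊆𝒴 : ∀ X → T (𝒳 X) → T (𝒴 (φ X))) where

  private
    module 𝒜ℬ = SupportsInMaximalIntersecting m max𝒜 maxℬ φ𝒜⊆ℬ
    module 𝒳𝒴 = SupportsInMaximalIntersecting m max𝒳 max𝒴 φ𝒳⊆𝒴
    module ℬ = MaximalIntersectingP maxℬ
    module 𝒴 = MaximalIntersectingP max𝒴

    L : List (Subset n)
    L = allSubsets n

  q w : ℕ
  q = ceilDiv k m
  w = k ⊓ ⌊ n /2⌋

  c : ℕ → ℤ
  c s = + C m k s

  a : ℕ → ℤ
  a ℓ = c ℓ - c (n ∸ ℓ)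

  D : Subset n → ℤ
  D F = 𝟙 (𝒴 F) - 𝟙 (ℬ F)

  h : ℕ → ℤ
  h s = sumFromTo q w (λ ℓ → a ℓ * 𝟙 ⌊ s ℕ.≟ ℓ ⌋)

  D-∁ : ∀ F → D (∁ F) ≡ - D F
  D-∁ F = begin
    y₂ - b₂                        ≡⟨ rearrange y₁ y₂ b₁ b₂ ⟩
    ((y₁ + y₂) - (b₁ + b₂)) - D F  ≡⟨ cong₂ (λ y b → (y - b) - D F) (𝒴.𝟙∈+𝟙∁∈ F) (ℬ.𝟙∈+𝟙∁∈ F) ⟩
    (i - i) - D F                  ≡⟨ cong (_- D F) (ℤ.+-inverseʳ i) ⟩
    + 0 - D F                      ≡⟨ ℤ.+-identityˡ (- D F) ⟩
    - D F                          ∎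
    where
    open ≡-Reasoning
    y₁ y₂ b₁ b₂ i : ℤ
    y₁ = 𝟙 (𝒴 F)
    y₂ = 𝟙 (𝒴 (∁ F))
    b₁ = 𝟙 (ℬ F)
    b₂ = 𝟙 (ℬ (∁ F))
    i  = 𝟙 ⌊ InP? F ⌋
    rearrange : ∀ y₁ y₂ b₁ b₂ → y₂ - b₂ ≡ ((y₁ + y₂) - (b₁ + b₂)) - (y₁ - b₁)
    rearrange = solve-∀

  mcard-difference : + mcard k 𝒳 - + mcard k 𝒜 ≡ Σℤ L (λ F → D F * c ∣ F ∣)
  mcard-difference = begin
    + mcard k 𝒳 - + mcard k 𝒜
      ≡⟨ cong₂ _-_ 𝒳𝒴.+mcard≡Σ 𝒜ℬ.+mcard≡Σ ⟩
    Σℤ L (λ F → 𝟙 (𝒴 F) * c ∣ F ∣) - Σℤ L (λ F → 𝟙 (ℬ F) * c ∣ F ∣)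
      ≡⟨ Σℤ-- L _ _ ⟩
    Σℤ L (λ F → (𝟙 (𝒴 F) * c ∣ F ∣) - (𝟙 (ℬ F) * c ∣ F ∣))
      ≡⟨ Σℤ-cong L (λ F → *-distribʳ-- (𝟙 (𝒴 F)) (𝟙 (ℬ F)) (c ∣ F ∣)) ⟩
    Σℤ L (λ F → D F * c ∣ F ∣) ∎
    where open ≡-Reasoning

  level-difference : ∀ ℓ → + scardLevel 𝒴 ℓ - + scardLevel ℬ ℓ
                         ≡ Σℤ L (λ F → D F * 𝟙 ⌊ ∣ F ∣ ℕ.≟ ℓ ⌋)
  level-difference ℓ = begin
    + scardLevel 𝒴 ℓ - + scardLevel ℬ ℓ
      ≡⟨ cong₂ _-_ (+scardLevel≡Σ 𝒴 ℓ) (+scardLevel≡Σ ℬ ℓ) ⟩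
    Σℤ L (λ F → 𝟙 (𝒴 F) * δ F) - Σℤ L (λ F → 𝟙 (ℬ F) * δ F)
      ≡⟨ Σℤ-- L _ _ ⟩
    Σℤ L (λ F → (𝟙 (𝒴 F) * δ F) - (𝟙 (ℬ F) * δ F))
      ≡⟨ Σℤ-cong L (λ F → *-distribʳ-- (𝟙 (𝒴 F)) (𝟙 (ℬ F)) (δ F)) ⟩
    Σℤ L (λ F → D F * δ F) ∎
    where
    open ≡-Reasoning
    δ : Subset n → ℤ
    δ F = 𝟙 ⌊ ∣ F ∣ ℕ.≟ ℓ ⌋

  sumFromTo-levels : sumFromTo q w (λ ℓ → a ℓ * (+ scardLevel 𝒴 ℓ - + scardLevel ℬ ℓ))
                     ≡ Σℤ L (λ F → D F * h ∣ F ∣)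
  sumFromTo-levels = begin
    Σℤ range (λ j → a (q ℕ.+ j) * (+ scardLevel 𝒴 (q ℕ.+ j) - + scardLevel ℬ (q ℕ.+ j)))
      ≡⟨ Σℤ-cong range (λ j → cong (a (q ℕ.+ j) *_) (level-difference (q ℕ.+ j))) ⟩
    Σℤ range (λ j → a (q ℕ.+ j) * Σℤ L (λ F → D F * δ F j))
      ≡⟨ Σℤ-cong range (λ j → Σℤ-*ˡ L (a (q ℕ.+ j)) _) ⟩
    Σℤ range (λ j → Σℤ L (λ F → a (q ℕ.+ j) * (D F * δ F j)))
      ≡⟨ Σℤ-swap range L _ ⟩
    Σℤ L (λ F → Σℤ range (λ j → a (q ℕ.+ j) * (D F * δ F j)))
      ≡⟨ Σℤ-cong L (λ F → Σℤ-cong range (λ j → *-left-commute (a (q ℕ.+ j)) (D F) (δ F j))) ⟩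
    Σℤ L (λ F → Σℤ range (λ j → D F * (a (q ℕ.+ j) * δ F j)))
      ≡⟨ Σℤ-cong L (λ F → Σℤ-*ˡ range (D F) _) ⟨
    Σℤ L (λ F → D F * h ∣ F ∣) ∎
    where
    open ≡-Reasoning
    range : List ℕ
    range = upTo (suc w ∸ q)
    δ : Subset n → ℕ → ℤ
    δ F j = 𝟙 ⌊ ∣ F ∣ ℕ.≟ q ℕ.+ j ⌋

  InRange : ℕ → Set
  InRange s = q ≤ s × s ≤ w

  inRange? : ∀ s → Dec (InRange s)
  inRange? s = q ℕ.≤? s ×-dec s ℕ.≤? w

  e : ℕ → ℤ
  e s = c s - h s

  e-inside : ∀ {s} → InRange s → e s ≡ c (n ∸ s)
  e-inside {s} (q≤s , s≤w) =
    trans (cong (λ x → c s - x) (sumFromTo-δ-inside a s q w q≤s s≤w)) (x-[x-y]≡y (c s) (c (n ∸ s)))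
    where
    x-[x-y]≡y : ∀ x y → x - (x - y) ≡ y
    x-[x-y]≡y = solve-∀

  e-outside : ∀ {s} → ¬ InRange s → e s ≡ c s
  e-outside {s} out = trans (cong (λ x → c s - x) (sumFromTo-δ-outside a s q w out)) (ℤ.+-identityʳ (c s))

  small-D*c≡0 : ∀ G → ∣ G ∣ < q → D G * c (n ∸ ∣ G ∣) ≡ + 0
  small-D*c≡0 G ∣G∣<q with C m k (n ∸ ∣ G ∣) ℕ.≟ 0
  ... | yes C≡0 = trans (cong (λ x → D G * + x) C≡0) (ℤ.*-zeroʳ (D G))
  ... | no C≢0  = trans (cong₂ (λ y b → (y - b) * c (n ∸ ∣ G ∣)) (𝟙-¬T (𝒳𝒴.small-∉ 1≤k G ∣G∣<q C≢0))
                                                            (𝟙-¬T (𝒜ℬ.small-∉ 1≤k G ∣G∣<q C≢0)))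
                        (ℤ.*-zeroˡ (c (n ∸ ∣ G ∣)))

  -- Below q the coefficient c s vanishes and small-∉ kills D G unless c (n ∸ s) = 0;
  -- above k both coefficients vanish, as n ∸ s ≥ s.
  lower-half-cancel : ∀ G {s} → ∣ G ∣ ≡ s → s ≤ ⌊ n /2⌋ → ¬ InRange s → D G * (c s - c (n ∸ s)) ≡ + 0
  lower-half-cancel G {s} refl s≤⌊n/2⌋ out with q ℕ.≤? s
  ... | no q≰s = begin
    D G * (c s - c (n ∸ s))  ≡⟨ cong (λ x → D G * (+ x - c (n ∸ s))) (C-below-ceilDiv m k s 1≤k (ℕ.≰⇒> q≰s)) ⟩
    D G * (+ 0 - c (n ∸ s))  ≡⟨ cong (D G *_) (ℤ.+-identityˡ (- c (n ∸ s))) ⟩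
    D G * - c (n ∸ s)        ≡⟨ ℤ.neg-distribʳ-* (D G) (c (n ∸ s)) ⟨
    - (D G * c (n ∸ s))      ≡⟨ cong -_ (small-D*c≡0 G (ℕ.≰⇒> q≰s)) ⟩
    + 0                      ∎
    where open ≡-Reasoning
  ... | yes q≤s = trans (cong₂ (λ x y → D G * (+ x - + y)) (C-above m k s k<s) (C-above m k (n ∸ s) k<n∸s))
                        (ℤ.*-zeroʳ (D G))
    where
    k<s : k < s
    k<s = ℕ.≰⇒> λ s≤k → out (q≤s , ℕ.⊓-glb s≤k s≤⌊n/2⌋)
    k<n∸s : k < n ∸ s
    k<n∸s = ℕ.<-≤-trans k<s (ℕ.≤-trans s≤⌊n/2⌋ (≤⌊n/2⌋⇒⌊n/2⌋≤n∸ n s≤⌊n/2⌋))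

  outside-cancel : ∀ F → ¬ InRange ∣ F ∣ → ¬ InRange (n ∸ ∣ F ∣) →
                   D F * (c ∣ F ∣ - c (n ∸ ∣ F ∣)) ≡ + 0
  outside-cancel F out out′ with ∣ F ∣ ℕ.≤? ⌊ n /2⌋
  ... | yes s≤⌊n/2⌋ = lower-half-cancel F refl s≤⌊n/2⌋ out
  ... | no  s≰⌊n/2⌋ = begin
    D F * (c s - c t)            ≡⟨ swap-signs (D F) (c s) (c t) ⟩
    - D F * (c t - c s)          ≡⟨ cong₂ (λ d r → d * (c t - c r)) (D-∁ F) (ℕ.m∸[m∸n]≡n (S.∣p∣≤n F)) ⟨
    D (∁ F) * (c t - c (n ∸ t))  ≡⟨ lower-half-cancel (∁ F) (S.∣∁p∣≡n∸∣p∣ F)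
                                                      (⌊n/2⌋<⇒n∸≤⌊n/2⌋ n (ℕ.≰⇒> s≰⌊n/2⌋)) out′ ⟩
    + 0                          ∎
    where
    open ≡-Reasoning
    s t : ℕ
    s = ∣ F ∣
    t = n ∸ ∣ F ∣
    swap-signs : ∀ d x y → d * (x - y) ≡ - d * (y - x)
    swap-signs = solve-∀

  e-cancel : ∀ F → D F * (e ∣ F ∣ - e (n ∸ ∣ F ∣)) ≡ + 0
  e-cancel F = by-range (inRange? s) (inRange? t)
    where
    s t : ℕ
    s = ∣ F ∣
    t = n ∸ ∣ F ∣
    n∸t≡s : n ∸ t ≡ s
    n∸t≡s = ℕ.m∸[m∸n]≡n (S.∣p∣≤n F)
    D*0 : ∀ {x} → x ≡ + 0 → D F * x ≡ + 0
    D*0 x≡0 = trans (cong (D F *_) x≡0) (ℤ.*-zeroʳ (D F))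

    by-range : Dec (InRange s) → Dec (InRange t) → D F * (e s - e t) ≡ + 0
    by-range (no out)     (no out′)     =
      trans (cong (D F *_) (cong₂ _-_ (e-outside out) (e-outside out′))) (outside-cancel F out out′)
    by-range (yes inside) (no out′)     = D*0 (trans (cong₂ _-_ (e-inside inside) (e-outside out′)) (ℤ.+-inverseʳ (c t)))
    by-range (no out)     (yes inside′) =
      D*0 (trans (cong₂ _-_ (e-outside out) (trans (e-inside inside′) (cong c n∸t≡s))) (ℤ.+-inverseʳ (c s)))
    by-range (yes inside) (yes inside′) = D*0 (trans (cong (λ r → e s - e r) (sym s≡t)) (ℤ.+-inverseʳ (e s)))
      where
      s≡t : s ≡ t
      s≡t = ≤⌊n/2⌋∧n∸≤⌊n/2⌋⇒≡ n (S.∣p∣≤n F) (ℕ.≤-trans (proj₂ inside) (ℕ.m⊓n≤n k _))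
                                             (ℕ.≤-trans (proj₂ inside′) (ℕ.m⊓n≤n k _))

  Σ-D*e≡0 : Σℤ L (λ F → D F * e ∣ F ∣) ≡ + 0
  Σ-D*e≡0 = Σℤ-allSubsets-∁-cancel n (λ F → D F * e ∣ F ∣) λ F → begin
    (D F * e ∣ F ∣) + (D (∁ F) * e ∣ ∁ F ∣)
      ≡⟨ cong₂ (λ d r → (D F * e ∣ F ∣) + d * e r) (D-∁ F) (S.∣∁p∣≡n∸∣p∣ F) ⟩
    (D F * e ∣ F ∣) + (- D F * e (n ∸ ∣ F ∣))
      ≡⟨ factor (D F) (e ∣ F ∣) (e (n ∸ ∣ F ∣)) ⟩
    D F * (e ∣ F ∣ - e (n ∸ ∣ F ∣))
      ≡⟨ e-cancel F ⟩
    + 0 ∎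
    where
    open ≡-Reasoning
    factor : ∀ d x y → d * x + - d * y ≡ d * (x - y)
    factor = solve-∀

  Σ-D*c≡Σ-D*h : Σℤ L (λ F → D F * c ∣ F ∣) ≡ Σℤ L (λ F → D F * h ∣ F ∣)
  Σ-D*c≡Σ-D*h = begin
    Σℤ L (λ F → D F * c ∣ F ∣)
      ≡⟨ Σℤ-cong L (λ F → split (D F) (c ∣ F ∣) (h ∣ F ∣)) ⟩
    Σℤ L (λ F → (D F * e ∣ F ∣) + (D F * h ∣ F ∣))
      ≡⟨ Σℤ-+ L _ _ ⟩
    Σℤ L (λ F → D F * e ∣ F ∣) + Σℤ L (λ F → D F * h ∣ F ∣)
      ≡⟨ cong (_+ Σℤ L (λ F → D F * h ∣ F ∣)) Σ-D*e≡0 ⟩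
    + 0 + Σℤ L (λ F → D F * h ∣ F ∣)
      ≡⟨ ℤ.+-identityˡ _ ⟩
    Σℤ L (λ F → D F * h ∣ F ∣) ∎
    where
    open ≡-Reasoning
    split : ∀ d x y → d * x ≡ d * (x - y) + d * y
    split = solve-∀

lemma3p6 : (n k : ℕ) → .{{_ : NonZero n}} → .{{_ : NonZero k}} → (m : Mul) →
    (𝒜 𝒳 : MFam n) → (ℬ 𝒴 : SFam n) →
    MaxIntersectingM m k 𝒜 → MaxIntersectingM m k 𝒳 →
    MaxIntersectingP ℬ → MaxIntersectingP 𝒴 →
    (∀ A → T (𝒜 A) → T (ℬ (φ A))) → (∀ X → T (𝒳 X) → T (𝒴 (φ X))) →
    (+ mcard k 𝒳) - (+ mcard k 𝒜)
      ≡ sumFromTo (ceilDiv k m) (k ⊓ ⌊ n /2⌋)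
          (λ ℓ → ((+ C m k ℓ) - (+ C m k (n ∸ ℓ)))
                 * ((+ scardLevel 𝒴 ℓ) - (+ scardLevel ℬ ℓ)))
lemma3p6 n k m 𝒜 𝒳 ℬ 𝒴 max𝒜 max𝒳 maxℬ max𝒴 φ𝒜⊆ℬ φ𝒳⊆𝒴 = begin
  + mcard k 𝒳 - + mcard k 𝒜                                      ≡⟨ mcard-difference ⟩
  Σℤ (allSubsets n) (λ F → D F * c ∣ F ∣)                        ≡⟨ Σ-D*c≡Σ-D*h ⟩
  Σℤ (allSubsets n) (λ F → D F * h ∣ F ∣)                        ≡⟨ sumFromTo-levels ⟨
  sumFromTo q w (λ ℓ → a ℓ * (+ scardLevel 𝒴 ℓ - + scardLevel ℬ ℓ)) ∎
  where
  open ≡-Reasoning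
  open CardinalityDifference (ℕ.>-nonZero⁻¹ k) m max𝒜 max𝒳 maxℬ max𝒴 φ𝒜⊆ℬ φ𝒳⊆𝒴
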